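{- Let $G=(V,E)$ be a connected graph with maximum degree $\Delta\geq 2$, and let $\mathcal{T}=(\mathcal{P},\mathcal{E})$ be a layering tree of $G$ (with respect to some vertex $s$). Then every part $P\in\mathcal{P}$ satisfies $|P|\leq \frac{\Delta^{\ell(\mathcal{T})+1}-1}{\Delta-1}\leq \Delta^{\ell(\mathcal{T})+1}$.
   Context: All graphs are simple, unweighted, undirected; $d_G$ is shortest-path distance. For a vertex $s$, the BFS layers are $L_i=\{v: d_G(s,v)=i\}$, and $L_{\le i-1}=L_0\cup\dots\cup L_{i-1}$ (with $L_{\le -1}=\emptyset$). For each $i\ge 0$, let $S_i^1,\dots,S_i^{s_i}$ be the connected components of $G\setminus L_{\le i-1}$ and $P_i^j=S_i^j\cap L_i$; the nonempty sets $P_i^j$ are the parts at layer $i$, and $\mathcal{P}$ is the set of all parts over all layers (a partition of $V$). The layering tree $\mathcal{T}=(\mathcal{P},\mathcal{E})$ has the parts as vertices, with $P,P'$ adjacent iff some $u\in P$, $u'\in P'$ are adjacent in $G$. The length of $\mathcal{T}$ is $\ell(\mathcal{T})=\max_{P\in\mathcal{P}}\max_{u,v\in P} d_G(u,v)$. -}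

module Defs where

open import Data.Nat using (ℕ; zero; suc; _+_; _∸_; _^_; _≤_; s≤s; z≤n; NonZero)
open import Data.Nat.DivMod using (_/_)
open import Data.Bool using (Bool; true; false)
open import Data.Fin using (Fin)
open import Data.Fin.Subset using (Subset; _∈_; ∣_∣)
open import Data.Vec using (tabulate)
open import Data.Product using (Σ; ∃; _×_; _,_)
open import Relation.Binary.PropositionalEquality using (_≡_)

record Graph (n : ℕ) : Set where
  field
    adj   : Fin n → Fin n → Bool
    sym   : ∀ u v → adj u v ≡ adj v u
    irref : ∀ v → adj v v ≡ false

module _ {n : ℕ} (G : Graph n) where
  open Graph G

  data Walk : Fin n → Fin n → ℕ → Set where
    here : ∀ {u} → Walk u u zero
    step : ∀ {u w v k} → adj u w ≡ true → Walk w v k → Walk u v (suc k)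

  Dist : Fin n → Fin n → ℕ → Set
  Dist u v k = Walk u v k × (∀ m → Walk u v m → k ≤ m)

  Connected : Set
  Connected = ∀ u v → ∃ λ k → Walk u v k

  degree : Fin n → ℕ
  degree v = ∣ tabulate (adj v) ∣

  MaxDegree : ℕ → Set
  MaxDegree Δ = (∀ v → degree v ≤ Δ) × (∃ λ v → degree v ≡ Δ)

  data WalkIn (A : Fin n → Set) : Fin n → Fin n → Set where
    here : ∀ {u} → A u → WalkIn A u u
    step : ∀ {u w v} → A u → adj u w ≡ true → WalkIn A w v → WalkIn A u v

  -- v ∈ G ∖ L_{≤ i-1}, i.e. d_G(s,v) ≥ i
  Outside : Fin n → ℕ → Fin n → Set
  Outside s i v = ∃ λ k → Dist s v k × i ≤ k

  -- P is a part of the layering w.r.t. s: P = S ∩ L_i for a connected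
  -- component S of G ∖ L_{≤ i-1}, with P nonempty (witnessed by u ∈ L_i ∩ S).
  IsPart : Fin n → Subset n → Set
  IsPart s P = Σ ℕ λ i → Σ (Fin n) λ u → Dist s u i ×
    (∀ v → (v ∈ P → Dist s v i × WalkIn (Outside s i) u v)
         × (Dist s v i × WalkIn (Outside s i) u v → v ∈ P))

  IsLength : Fin n → ℕ → Set
  IsLength s ℓ =
    (∀ P → IsPart s P → ∀ u v → u ∈ P → v ∈ P → ∀ k → Dist u v k → k ≤ ℓ)
    × (Σ (Subset n) λ P → IsPart s P × Σ (Fin n) λ u → Σ (Fin n) λ v →
         u ∈ P × v ∈ P × Dist u v ℓ)

-- (Δ^{ℓ+1} - 1)/(Δ - 1), defined for Δ ≥ 2 (exact division in ℕ).
geomBound : (Δ ℓ : ℕ) → 2 ≤ Δ → ℕ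
geomBound (suc (suc k)) ℓ (s≤s (s≤s _)) = (suc (suc k) ^ suc ℓ ∸ 1) / suc k

{-# OPTIONS --safe #-}

-- A part P with root u lies in the ball of radius ℓ(T) around u, since
-- every vertex of P is reachable from u and at distance at most ℓ(T) from it.
-- In a graph of maximum degree Δ the ball of radius j has at most
-- 1 + Δ + ⋯ + Δ^j = (Δ^{j+1} - 1)/(Δ - 1) vertices.

module Submission where

open import Defs
open import Data.Nat using (ℕ; zero; suc; _+_; _*_; _∸_; _^_; _≤_; _<_; s≤s; z≤n)
open import Data.Nat.Properties
open import Data.Nat.DivMod using (_/_; m*n/n≡m)
open import Data.Nat.Tactic.RingSolver using (solve-∀)
open import Data.Bool using (true)
open import Data.Bool.Properties using () renaming (_≟_ to _≟ᵇ_)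
open import Data.Fin using (Fin; zero; suc)
open import Data.Fin.Properties using (any?) renaming (_≟_ to _≟ᶠ_)
open import Data.Fin.Subset using (Subset; ∣_∣; _∈_; _∪_; _⊆_; ⁅_⁆; ⊥; inside; outside)
open import Data.Fin.Subset.Properties using (x∈⁅x⁆; ∣⁅x⁆∣≡1; ∣⊥∣≡0; x∈p∪q⁺; p⊆q⇒∣p∣≤∣q∣)
open import Data.Vec using ([]; _∷_; tabulate; here; there)
open import Data.Vec.Properties using (lookup∘tabulate; lookup⇒[]=)
open import Data.Product using (∃; _×_; _,_; proj₁; proj₂)
open import Data.Sum using (_⊎_; inj₁; inj₂; [_,_]′)
open import Function using (_∘_; id)
open import Relation.Nullary using (Dec; ¬_; yes; no; contradiction)
open import Relation.Nullary.Decidable using (map′; _×-dec_)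
open import Relation.Unary using (Pred; Decidable)
open import Relation.Binary.PropositionalEquality using (_≡_; refl; sym; trans; cong; module ≡-Reasoning)

module _ {p} {P : Pred ℕ p} (P? : Decidable P) where

  least-below : ∀ b → (∀ {m} → m < b → ¬ P m) ⊎ (∃ λ m → P m × (∀ m′ → P m′ → m ≤ m′))
  least-below zero = inj₁ λ ()
  least-below (suc b) with least-below b | P? b
  ... | inj₂ found | _      = inj₂ found
  ... | inj₁ none  | yes pb = inj₂ (b , pb , λ m′ pm′ → ≮⇒≥ λ m′<b → none m′<b pm′)
  ... | inj₁ none  | no ¬pb = inj₁ λ m<1+b → [ none , (λ { refl → ¬pb }) ]′ (m<1+n⇒m<n∨m≡n m<1+b)

  least-witness : ∀ {k} → P k → ∃ λ m → P m × (∀ m′ → P m′ → m ≤ m′)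
  least-witness {k} pk = [ (λ none → contradiction pk (none (n<1+n k))) , id ]′ (least-below (suc k))

∣p∪q∣≤∣p∣+∣q∣ : ∀ {n} (p q : Subset n) → ∣ p ∪ q ∣ ≤ ∣ p ∣ + ∣ q ∣
∣p∪q∣≤∣p∣+∣q∣ [] [] = z≤n
∣p∪q∣≤∣p∣+∣q∣ (outside ∷ p) (outside ∷ q) = ∣p∪q∣≤∣p∣+∣q∣ p q
∣p∪q∣≤∣p∣+∣q∣ (outside ∷ p) (inside ∷ q) =
  ≤-trans (s≤s (∣p∪q∣≤∣p∣+∣q∣ p q)) (≤-reflexive (sym (+-suc ∣ p ∣ ∣ q ∣)))
∣p∪q∣≤∣p∣+∣q∣ (inside ∷ p) (outside ∷ q) = s≤s (∣p∪q∣≤∣p∣+∣q∣ p q)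
∣p∪q∣≤∣p∣+∣q∣ (inside ∷ p) (inside ∷ q) =
  s≤s (≤-trans (∣p∪q∣≤∣p∣+∣q∣ p q) (+-monoʳ-≤ ∣ p ∣ (n≤1+n ∣ q ∣)))

⋃-over : ∀ {m n} → Subset m → (Fin m → Subset n) → Subset n
⋃-over []            f = ⊥
⋃-over (inside ∷ W)  f = f zero ∪ ⋃-over W (f ∘ suc)
⋃-over (outside ∷ W) f = ⋃-over W (f ∘ suc)

syntax ⋃-over W (λ x → B) = ⋃[ x ∈ W ] B

y∈⋃⁺ : ∀ {m n} {W : Subset m} {f : Fin m → Subset n} {x y} →
       x ∈ W → y ∈ f x → y ∈ ⋃-over W f
y∈⋃⁺ {W = inside ∷ W}  {x = zero}  here       y∈fx = x∈p∪q⁺ (inj₁ y∈fx)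
y∈⋃⁺ {W = inside ∷ W}  {x = suc x} (there x∈W) y∈fx = x∈p∪q⁺ (inj₂ (y∈⋃⁺ x∈W y∈fx))
y∈⋃⁺ {W = outside ∷ W} {x = suc x} (there x∈W) y∈fx = y∈⋃⁺ x∈W y∈fx

∣⋃∣≤∣W∣*c : ∀ {m n} (W : Subset m) {f : Fin m → Subset n} {c} →
            (∀ x → ∣ f x ∣ ≤ c) → ∣ ⋃-over W f ∣ ≤ ∣ W ∣ * c
∣⋃∣≤∣W∣*c {n = n} [] _ = ≤-reflexive (∣⊥∣≡0 n)
∣⋃∣≤∣W∣*c (inside ∷ W) {f} ∣f∣≤c =
  ≤-trans (∣p∪q∣≤∣p∣+∣q∣ (f zero) _) (+-mono-≤ (∣f∣≤c zero) (∣⋃∣≤∣W∣*c W (∣f∣≤c ∘ suc)))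
∣⋃∣≤∣W∣*c (outside ∷ W) ∣f∣≤c = ∣⋃∣≤∣W∣*c W (∣f∣≤c ∘ suc)

geomSum : ℕ → ℕ → ℕ
geomSum Δ zero    = 1
geomSum Δ (suc j) = 1 + Δ * geomSum Δ j

geomSum-identity : ∀ d j → geomSum (suc d) j * d + 1 ≡ suc d ^ suc j
geomSum-identity d zero    = base d
  where
  base : ∀ d → 1 * d + 1 ≡ suc d * 1
  base = solve-∀
geomSum-identity d (suc j) = begin
  (1 + suc d * g) * d + 1 ≡⟨ horner-step d g ⟩
  suc d * (g * d + 1)     ≡⟨ cong (suc d *_) (geomSum-identity d j) ⟩
  suc d ^ suc (suc j)     ∎
  where
  open ≡-Reasoning
  g = geomSum (suc d) j
  horner-step : ∀ d g → (1 + suc d * g) * d + 1 ≡ suc d * (g * d + 1)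
  horner-step = solve-∀

geomBound≡geomSum : ∀ {Δ} ℓ (h : 2 ≤ Δ) → geomBound Δ ℓ h ≡ geomSum Δ ℓ
geomBound≡geomSum {suc (suc d)} ℓ (s≤s (s≤s z≤n)) = begin
  (D ^ suc ℓ ∸ 1) / suc d     ≡⟨ cong (λ x → (x ∸ 1) / suc d) (sym (geomSum-identity (suc d) ℓ)) ⟩
  (g * suc d + 1 ∸ 1) / suc d ≡⟨ cong (_/ suc d) (m+n∸n≡m (g * suc d) 1) ⟩
  g * suc d / suc d           ≡⟨ m*n/n≡m g (suc d) ⟩
  g                           ∎
  where
  open ≡-Reasoning
  D = suc (suc d)
  g = geomSum D ℓ

geomSum≤^ : ∀ {Δ} ℓ → 2 ≤ Δ → geomSum Δ ℓ ≤ Δ ^ suc ℓ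
geomSum≤^ {suc (suc d)} ℓ (s≤s (s≤s z≤n)) = begin
  g               ≤⟨ m≤m*n g (suc d) ⟩
  g * suc d       ≤⟨ m≤m+n (g * suc d) 1 ⟩
  g * suc d + 1   ≡⟨ geomSum-identity (suc d) ℓ ⟩
  suc (suc d) ^ suc ℓ ∎
  where
  open ≤-Reasoning
  g = geomSum (suc (suc d)) ℓ

module _ {n} (G : Graph n) where
  open Graph G using (adj)

  neighbours : Fin n → Subset n
  neighbours w = tabulate (adj w)

  ∈-neighbours : ∀ {w x} → adj w x ≡ true → x ∈ neighbours w
  ∈-neighbours {w} {x} wx = lookup⇒[]= x (neighbours w) (trans (lookup∘tabulate (adj w) x) wx)

  walk? : ∀ u v k → Dec (Walk G u v k)
  walk? u v zero with u ≟ᶠ v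
  ... | yes refl = yes here
  ... | no  u≢v  = no λ { here → u≢v refl }
  walk? u v (suc k) =
    map′ (λ (w , uw , wv) → step uw wv) (λ { (step uw wv) → _ , uw , wv })
         (any? λ w → (adj u w ≟ᵇ true) ×-dec walk? w v k)

  shortest-walk : ∀ {u v k} → Walk G u v k → ∃ (Dist G u v)
  shortest-walk {u} {v} = least-witness (walk? u v)

  WalkIn⇒Walk : ∀ {A u v} → WalkIn G A u v → ∃ (Walk G u v)
  WalkIn⇒Walk (here _) = 0 , here
  WalkIn⇒Walk (step _ uw wv) = let k , wv′ = WalkIn⇒Walk wv in suc k , step uw wv′

  ball : Fin n → ℕ → Subset n
  ball w zero    = ⁅ w ⁆
  ball w (suc j) = ⁅ w ⁆ ∪ ⋃[ x ∈ neighbours w ] ball x j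

  centre∈ball : ∀ w j → w ∈ ball w j
  centre∈ball w zero    = x∈⁅x⁆ w
  centre∈ball w (suc j) = x∈p∪q⁺ (inj₁ (x∈⁅x⁆ w))

  Walk⇒∈ball : ∀ {u v k j} → Walk G u v k → k ≤ j → v ∈ ball u j
  Walk⇒∈ball {j = j} here _ = centre∈ball _ j
  Walk⇒∈ball {j = suc j} (step uw wv) (s≤s k≤j) =
    x∈p∪q⁺ (inj₂ (y∈⋃⁺ (∈-neighbours uw) (Walk⇒∈ball wv k≤j)))

  ⊆-ball : ∀ {P u ℓ} → (∀ {v} → v ∈ P → ∃ (Walk G u v)) →
           (∀ {v m} → v ∈ P → Dist G u v m → m ≤ ℓ) → P ⊆ ball u ℓ
  ⊆-ball reachable close v∈P =
    let m , dist = shortest-walk (proj₂ (reachable v∈P))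
    in Walk⇒∈ball (proj₁ dist) (close v∈P dist)

  ∣ball∣≤geomSum : ∀ {Δ} → (∀ v → degree G v ≤ Δ) → ∀ w j → ∣ ball w j ∣ ≤ geomSum Δ j
  ∣ball∣≤geomSum deg≤Δ w zero = ≤-reflexive (∣⁅x⁆∣≡1 w)
  ∣ball∣≤geomSum {Δ} deg≤Δ w (suc j) = begin
    ∣ ⁅ w ⁆ ∪ ⋃[ x ∈ neighbours w ] ball x j ∣
      ≤⟨ ∣p∪q∣≤∣p∣+∣q∣ ⁅ w ⁆ _ ⟩
    ∣ ⁅ w ⁆ ∣ + ∣ ⋃[ x ∈ neighbours w ] ball x j ∣
      ≤⟨ +-mono-≤ (≤-reflexive (∣⁅x⁆∣≡1 w))
                  (∣⋃∣≤∣W∣*c (neighbours w) λ x → ∣ball∣≤geomSum deg≤Δ x j) ⟩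
    1 + degree G w * geomSum Δ j
      ≤⟨ +-monoʳ-≤ 1 (*-monoˡ-≤ (geomSum Δ j) (deg≤Δ w)) ⟩
    1 + Δ * geomSum Δ j ∎
    where open ≤-Reasoning

lemma2 : ∀ {n} (G : Graph n) → Connected G → (Δ : ℕ) → MaxDegree G Δ → (h : 2 ≤ Δ)
           → (s : Fin n) → (ℓ : ℕ) → IsLength G s ℓ
           → ∀ (P : Subset n) → IsPart G s P
           → ∣ P ∣ ≤ geomBound Δ ℓ h × geomBound Δ ℓ h ≤ Δ ^ suc ℓ
lemma2 G _ Δ (deg≤Δ , _) h s ℓ (diam≤ℓ , _) P part@(i , u , su≡i , ∈P⇔)
  rewrite geomBound≡geomSum ℓ h =
  ≤-trans (p⊆q⇒∣p∣≤∣q∣ P⊆ball) (∣ball∣≤geomSum G deg≤Δ u ℓ) , geomSum≤^ ℓ h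
  where
  u∈P : u ∈ P
  u∈P = proj₂ (∈P⇔ u) (su≡i , here (i , su≡i , ≤-refl))
  P⊆ball : P ⊆ ball G u ℓ
  P⊆ball = ⊆-ball G (λ {v} v∈P → WalkIn⇒Walk G (proj₂ (proj₁ (∈P⇔ v) v∈P)))
                    (λ {v} {m} v∈P → diam≤ℓ P part u v u∈P v∈P m)
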